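{- Let $G$ be a simple graph with vertex set $[d]$, $d\ge1$, and let $K_G$ be its coloring ideal in the ring $R$. For every integer $n\ge0$ there is a one-to-one correspondence (bijection) between the $(n+1)$-colorings of $G$ and the monomials of degree $n$ in $K_G$.
   Context: $G$ is a simple graph with vertex set $[d]$. An $m$-coloring of $G$ is a map $\phi:[d]\to[m]$ (not necessarily surjective) with $\phi(x)\neq\phi(y)$ for adjacent $x,y$. For $\pi=a_1\cdots a_d\in\mathcal S_d$ and $k\in[d]$, $\ell(k)$ is the largest $r\ge0$ such that there are indices $i_0<\cdots<i_r=k$ with $a_{i_{s-1}}$ adjacent to $a_{i_s}$ in $G$ for all $s$. An integer $k\in\{0,\dots,d-1\}$ is a cut of $\pi$ if $k=0$, or $\ell(k)<\ell(k+1)$, or $\ell(k)=\ell(k+1)$ and $a_k<a_{k+1}$. If the cuts are $0=i_1<\cdots<i_q$, the $G$-sequence of $\pi$ is $S_1,\dots,S_q$ with $S_j=\{a_{i_j+1},\dots,a_{i_{j+1}}\}$ for $j<q$ and $S_q=\{a_{i_q+1},\dots,a_d\}$; the short $G$-sequence is $S_1,\dots,S_{q-1}$. Let $\mathbb k$ be a field, $A=\mathbb k[x_S : S\subseteq[d]]$ (one variable for each subset of $[d]$, each of degree $1$), $I$ the ideal of $A$ generated by all $x_Sx_T$ with $S\not\subseteq T$ and $T\not\subseteq S$, and $R=A/I$ (the face ring of the order complex of the Boolean algebra on $d$ atoms). The (nonzero) monomials of $R$ are the $x_{S_1}^{e_1}\cdots x_{S_k}^{e_k}$ with $S_1\subsetneq\cdots\subsetneq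 S_k$. A basic coloring monomial for $G$ is a monomial $x_{S_1}x_{S_2}\cdots x_{S_k}$ ($k\ge0$) with $\emptyset\subsetneq S_1\subsetneq\cdots\subsetneq S_k\subsetneq[d]$ such that some $\pi\in\mathcal S_d$ has short $G$-sequence $S_1,S_2\setminus S_1,\dots,S_k\setminus S_{k-1}$. A coloring monomial is a nonzero monomial of $R$ divisible by a basic coloring monomial. The coloring ideal $K_G$ is the ideal of $R$ generated by the coloring monomials (equivalently by the basic ones); its monomials of degree $n$ are the coloring monomials of degree $n$. -}

module Defs where

open import Level using (0ℓ)
open import Data.Bool using (Bool; true; false; if_then_else_; _∨_; _∧_)
open import Data.Nat using (ℕ; zero; suc; _⊔_; _<ᵇ_; _≡ᵇ_; _≤_)
open import Data.Fin using (Fin; toℕ)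
open import Data.Fin.Subset using (Subset; ⊥; ⊤; ⁅_⁆; _∪_; _─_; _⊂_)
open import Data.Fin.Permutation using (Permutation′; _⟨$⟩ʳ_)
open import Data.List using (List; []; _∷_; [_]; _++_; map; foldr; tabulate)
open import Data.Nat.ListAction using (sum)
open import Data.List.Membership.Propositional using (_∈_)
open import Data.List.Relation.Unary.All using (All)
open import Data.List.Relation.Unary.Linked using (Linked)
open import Data.Product using (Σ; ∃; _×_; _,_; proj₁; proj₂)
open import Relation.Binary.PropositionalEquality using (_≡_; _≢_; refl; sym; trans)
open import Relation.Binary.Bundles using (Setoid)

record Graph (d : ℕ) : Set where
  field
    adj    : Fin d → Fin d → Bool
    adj-sym  : ∀ x y → adj x y ≡ adj y x
    loopless : ∀ x → adj x x ≡ false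

open Graph public

Coloring : ∀ {d} → Graph d → ℕ → Set
Coloring {d} G m =
  Σ (Fin d → Fin m) λ φ → ∀ x y → adj G x y ≡ true → φ x ≢ φ y

ColoringSetoid : ∀ {d} → Graph d → ℕ → Setoid 0ℓ 0ℓ
ColoringSetoid G m = record
  { Carrier = Coloring G m
  ; _≈_ = λ φ ψ → ∀ x → proj₁ φ x ≡ proj₁ ψ x
  ; isEquivalence = record
    { refl = λ x → refl
    ; sym = λ p x → sym (p x)
    ; trans = λ p q x → trans (p x) (q x)
    }
  }

module _ {d : ℕ} (G : Graph d) where

  -- Given the already processed prefix a_1..a_{k-1} together with their
  -- ℓ-values, ℓ(k) for the next letter v = a_k is the length of a longest
  -- adjacent chain i_0 < ... < i_r = k, i.e. 0 if no earlier letter is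
  -- adjacent to v, and otherwise max { ℓ(j) + 1 : j < k, a_j ~ a_k }.
  ℓnext : List (Fin d × ℕ) → Fin d → ℕ
  ℓnext prev v = foldr (λ p m → if adj G (proj₁ p) v then suc (proj₂ p) ⊔ m else m) 0 prev

  withℓ-aux : List (Fin d × ℕ) → List (Fin d) → List (Fin d × ℕ)
  withℓ-aux prev []       = prev
  withℓ-aux prev (v ∷ vs) = withℓ-aux (prev ++ [ (v , ℓnext prev v) ]) vs

  withℓ : List (Fin d) → List (Fin d × ℕ)
  withℓ w = withℓ-aux [] w

  isCut : Fin d × ℕ → Fin d × ℕ → Bool
  isCut (a , l) (b , m) = (l <ᵇ m) ∨ ((l ≡ᵇ m) ∧ (toℕ a <ᵇ toℕ b))

  -- Split a word at its cuts (0 is always a cut).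
  -- Arguments: previous letter, current block, rest of the word.
  blocksFrom : Fin d × ℕ → List (Fin d) → List (Fin d × ℕ) → List (List (Fin d))
  blocksFrom p cur []       = cur ∷ []
  blocksFrom p cur (q ∷ qs) =
    if isCut p q then cur ∷ blocksFrom q [ proj₁ q ] qs
                 else blocksFrom q (proj₁ q ∷ cur) qs

  blocks : List (Fin d × ℕ) → List (List (Fin d))
  blocks []       = []
  blocks (q ∷ qs) = blocksFrom q [ proj₁ q ] qs

  toSubset : List (Fin d) → Subset d
  toSubset = foldr (λ x s → ⁅ x ⁆ ∪ s) ⊥

  word : Permutation′ d → List (Fin d)
  word π = tabulate (π ⟨$⟩ʳ_)

  GSeq : Permutation′ d → List (Subset d)
  GSeq π = map toSubset (blocks (withℓ (word π)))

dropLast : {A : Set} → List A → List A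
dropLast []           = []
dropLast (x ∷ [])     = []
dropLast (x ∷ y ∷ xs) = x ∷ dropLast (y ∷ xs)

shortGSeq : ∀ {d} → Graph d → Permutation′ d → List (Subset d)
shortGSeq G π = dropLast (GSeq G π)

diffs : ∀ {d} → Subset d → List (Subset d) → List (Subset d)
diffs prev []       = []
diffs prev (S ∷ Ss) = (S ─ prev) ∷ diffs S Ss

-- x_{S_1} ⋯ x_{S_k} (given by the list S_1, ..., S_k) is a basic coloring
-- monomial: ∅ ⊊ S_1 ⊊ ⋯ ⊊ S_k ⊊ [d] and some permutation π has short
-- G-sequence S_1, S_2 \ S_1, ..., S_k \ S_{k-1}.
IsBasicColoringMonomial : ∀ {d} → Graph d → List (Subset d) → Set
IsBasicColoringMonomial {d} G Ss =
  Linked _⊂_ (⊥ ∷ Ss ++ [ ⊤ ]) ×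
  ∃ λ (π : Permutation′ d) → shortGSeq G π ≡ diffs ⊥ Ss

-- A (nonzero) monomial of R: x_{S_1}^{e_1} ⋯ x_{S_k}^{e_k}, given by the
-- list of pairs (S_i , e_i), with S_1 ⊊ ⋯ ⊊ S_k and all e_i ≥ 1.
IsMonomial : ∀ {d} → List (Subset d × ℕ) → Set
IsMonomial M =
  Linked (λ p q → proj₁ p ⊂ proj₁ q) M × All (λ p → 1 ≤ proj₂ p) M

degree : ∀ {d} → List (Subset d × ℕ) → ℕ
degree M = sum (map proj₂ M)

-- The squarefree monomial x_{T_1} ⋯ x_{T_j} divides the monomial M
-- iff every T_i occurs in M (with positive exponent).
Divides : ∀ {d} → List (Subset d) → List (Subset d × ℕ) → Set
Divides Ts M = All (λ T → T ∈ map proj₁ M) Ts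

IsColoringMonomial : ∀ {d} → Graph d → List (Subset d × ℕ) → Set
IsColoringMonomial G M =
  IsMonomial M × ∃ λ B → IsBasicColoringMonomial G B × Divides B M

KMonomial : ∀ {d} → Graph d → ℕ → Set
KMonomial {d} G n =
  Σ (List (Subset d × ℕ)) λ M → IsColoringMonomial G M × degree M ≡ n

KMonomialSetoid : ∀ {d} → Graph d → ℕ → Setoid 0ℓ 0ℓ
KMonomialSetoid G n = record
  { Carrier = KMonomial G n
  ; _≈_ = λ M N → proj₁ M ≡ proj₁ N
  ; isEquivalence = record
    { refl = refl
    ; sym = sym
    ; trans = trans
    }
  }

-- A map φ : [d] → [n+1] is recorded by its chain of level sets {φ ≤ 0} ⊆ {φ ≤ 1} ⊆ ⋯ ⊆ {φ ≤ n-1};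
-- run-length encoding the chain (repeated sets become exponents) gives a monomial of degree n of R,
-- and every such monomial arises from exactly one φ, which colours x by the first set containing x.
-- So it remains to show that φ is proper exactly when its monomial is divisible by a basic coloring
-- monomial.
--
-- The sets of the basic monomial of a permutation π are the prefixes of π that end at a cut. Along an
-- edge, read from left to right, ℓ strictly increases, and ℓ can only increase across a cut; hence
-- two adjacent vertices are always separated by one of these sets, and any monomial divisible by the
-- basic monomial gives them different colours.
--
-- Conversely, for a proper φ list the vertices by increasing colour, then by decreasing depth (the
-- length of a longest path ending at the vertex along which colours increase), then by decreasing
-- index. In this word ℓ is the depth, so no cut falls inside a colour class, and every prefix ending
-- at a cut is a level set {φ ≤ i} with i < n.

module Submission where

open import Defs

open import Data.Bool using (Bool; true; false; if_then_else_; T; _∧_)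
open import Data.Bool.Properties using (T-≡; T-∨; T-∧) renaming (_≟_ to _≟ᵇ_)
open import Data.Empty using (⊥-elim)
open import Data.Fin using (Fin; toℕ; cast; fromℕ<)
import Data.Fin as Fin
open import Data.Fin.Properties using (cast-is-id; cast-involutive; toℕ<n; toℕ-injective; toℕ-fromℕ<)
open import Data.Fin.Permutation
  using (Permutation′; permutation; _⟨$⟩ʳ_; _⟨$⟩ˡ_; inverseˡ; inverseʳ)
open import Data.Fin.Subset
  using (Subset; ⊥; ⊤; ⁅_⁆; _∪_; _─_; _⊆_; _⊂_; Nonempty; inside; outside)
  renaming (_∈_ to _∈ₛ_; _∉_ to _∉ₛ_)
open import Data.Fin.Subset.Properties
  using ( _∈?_; ∉⊥; ∈⊤; ⊆⊤; x∈⁅x⁆; x∈⁅y⁆⇒x≡y; ⊆-refl; ⊆-trans; ⊆-antisym; drop-∷-⊆; s⊂s; out⊂in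
        ; p⊂q⇒p⊆q; ⊂-irref; p⊆p∪q; q⊆p∪q; x∈p∪q⁻; x∈p∪q⁺; p─q⊆p; x∈p∧x∉q⇒x∈p─q
        ; ∪-identityˡ; ∪-identityʳ; ∪-assoc; ∪-comm)
open import Data.List using (List; []; _∷_; [_]; _++_; map; foldr; replicate; length; tabulate; allFin)
import Data.List as List
open import Data.List.Properties
  using ( length-++; length-replicate; length-tabulate; ++-identityʳ; ++-assoc
        ; map-++; map-cong; map-∘; map-id; tabulate-lookup)
import Data.List.Properties as List
open import Data.List.Membership.Propositional using (_∈_; _∉_)
open import Data.List.Membership.Propositional.Properties
  using (∈-++⁺ʳ; ∈-++⁻; ∈-map⁺; ∈-map⁻; ∈-tabulate⁺; ∈-lookup; ∈-allFin)
open import Data.List.Relation.Unary.All using (All; []; _∷_)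
import Data.List.Relation.Unary.All as All
import Data.List.Relation.Unary.All.Properties as All
open import Data.List.Relation.Unary.AllPairs using (AllPairs; []; _∷_)
import Data.List.Relation.Unary.AllPairs as AllPairs
import Data.List.Relation.Unary.AllPairs.Properties as AllPairs
open import Data.List.Relation.Unary.Any using (here; there)
import Data.List.Relation.Unary.Any as Any
open import Data.List.Relation.Unary.Any.Properties using (¬Any[]; lookup-index)
open import Data.List.Relation.Unary.Linked using (Linked; []; [-]; _∷_)
import Data.List.Relation.Unary.Linked as Linked
open import Data.List.Relation.Unary.Linked.Properties using (Linked⇒AllPairs)
open import Data.List.Relation.Unary.Unique.Propositional using (Unique)
import Data.List.Relation.Unary.Unique.Propositional.Properties as Unique
open import Data.List.Relation.Binary.Permutation.Propositional using (↭-sym; ↭⇒↭ₛ)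
open import Data.List.Relation.Binary.Permutation.Propositional.Properties using (∈-resp-↭; ↭-length)
import Data.List.Relation.Binary.Permutation.Setoid.Properties as ↭ₛ
open import Data.Nat using (ℕ; zero; suc; pred; _+_; _⊔_; _≤_; _<_; z≤n; s≤s; s≤s⁻¹; _≡ᵇ_; _<ᵇ_)
open import Data.Nat.Properties
  using ( ≤-refl; ≤-reflexive; ≤-trans; ≤-antisym; ≤-<-trans; <-≤-trans; <-irrefl; <⇒≱; ≮⇒≥; ≤∧≢⇒<; <⇒≢
        ; n≤0⇒n≡0; pred-mono-≤; ⊔-lub; m≤m⊔n; m≤n⊔m; <⇒<ᵇ; <ᵇ⇒<; ≡ᵇ⇒≡; ≤-decTotalOrder)
open import Data.Product using (Σ; ∃; ∃₂; _×_; _,_; proj₁; proj₂)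
import Data.Product.Relation.Binary.Lex.NonStrict as Lex
open import Data.Sum using (_⊎_; inj₁; inj₂; [_,_]′)
import Data.Sum as Sum
import Data.Vec.Base as Vec
open Vec using ([]; _∷_)
open import Data.Vec.Properties using (≡-dec; lookup∘tabulate; tabulate-cong; []=⇒lookup; lookup⇒[]=)
open import Function using (_∘_; _on_; case_of_)
open import Function.Bundles using (Bijection; Equivalence)
open Equivalence using (to; from)
open import Relation.Binary.Bundles using (DecTotalOrder)
import Relation.Binary.Construct.Flip.EqAndOrd as Flip
import Relation.Binary.Construct.On as On
open import Relation.Binary.Definitions using (DecidableEquality; Reflexive)
open import Relation.Binary.PropositionalEquality
  using (_≡_; _≢_; refl; sym; trans; cong; cong₂; subst; subst₂; setoid)
open import Relation.Binary.PropositionalEquality.Properties using (module ≡-Reasoning)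
open import Relation.Nullary using (¬_; yes; no)

dropLast-∷ : ∀ {A : Set} (x : A) {ys} → (∃₂ λ y ys′ → ys ≡ y ∷ ys′) → dropLast (x ∷ ys) ≡ x ∷ dropLast ys
dropLast-∷ x (_ , _ , refl) = refl

module _ {A : Set} {R : A → A → Set} where

  AllPairs-pivot : ∀ xs {y zs} → AllPairs R (xs ++ y ∷ zs) → All (λ x → R x y) xs × All (R y) zs
  AllPairs-pivot []       (Ry ∷ _)     = [] , Ry
  AllPairs-pivot (x ∷ xs) (Rx ∷ rest) =
    let (before , after) = AllPairs-pivot xs rest in All.lookup Rx (∈-++⁺ʳ xs (here refl)) ∷ before , after

  Linked-++⁻ˡ : ∀ xs {ys} → Linked R (xs ++ ys) → Linked R xs
  Linked-++⁻ˡ []           _       = []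
  Linked-++⁻ˡ (x ∷ [])     _       = [-]
  Linked-++⁻ˡ (x ∷ y ∷ xs) (r ∷ l) = r ∷ Linked-++⁻ˡ (y ∷ xs) l

Unique-∷⇒∉ : ∀ {A : Set} {x y : A} {xs} → Unique (x ∷ xs) → y ∈ xs → y ≢ x
Unique-∷⇒∉ (x∉ ∷ _) y∈ y≡x = All.lookup x∉ y∈ (sym y≡x)

module _ {A : Set} where

  maxOver : (A → Bool) → (A → ℕ) → List A → ℕ
  maxOver c g = foldr (λ u m → if c u then g u ⊔ m else m) 0

  maxOver-upper : ∀ c g {u} xs → u ∈ xs → c u ≡ true → g u ≤ maxOver c g xs
  maxOver-upper c g (x ∷ xs) (here refl) cu rewrite cu = m≤m⊔n (g x) (maxOver c g xs)
  maxOver-upper c g (x ∷ xs) (there u∈xs) cu with c x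
  ... | true  = ≤-trans (maxOver-upper c g xs u∈xs cu) (m≤n⊔m (g x) (maxOver c g xs))
  ... | false = maxOver-upper c g xs u∈xs cu

  maxOver-least : ∀ c g xs {k} → (∀ {u} → u ∈ xs → c u ≡ true → g u ≤ k) → maxOver c g xs ≤ k
  maxOver-least c g []       bound = z≤n
  maxOver-least c g (x ∷ xs) bound with c x in cx
  ... | true  = ⊔-lub (bound (here refl) cx) (maxOver-least c g xs (bound ∘ there))
  ... | false = maxOver-least c g xs (bound ∘ there)

  maxOver-cong : ∀ c {g h} xs → (∀ {u} → c u ≡ true → g u ≡ h u) → maxOver c g xs ≡ maxOver c h xs
  maxOver-cong c []       g≗h = refl
  maxOver-cong c (x ∷ xs) g≗h with c x in cx
  ... | true  = cong₂ _⊔_ (g≗h cx) (maxOver-cong c xs g≗h)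
  ... | false = maxOver-cong c xs g≗h

  maxOver-≡ : ∀ c c′ g xs ys →
              (∀ {u} → u ∈ xs → c u ≡ true → u ∈ ys × c′ u ≡ true) →
              (∀ {u} → u ∈ ys → c′ u ≡ true → u ∈ xs × c u ≡ true) →
              maxOver c g xs ≡ maxOver c′ g ys
  maxOver-≡ c c′ g xs ys xs⊆ys ys⊆xs = ≤-antisym
    (maxOver-least c g xs λ u∈ cu → let (u∈ys , c′u) = xs⊆ys u∈ cu in maxOver-upper c′ g ys u∈ys c′u)
    (maxOver-least c′ g ys λ u∈ c′u → let (u∈xs , cu) = ys⊆xs u∈ c′u in maxOver-upper c g xs u∈xs cu)

maxOver-map : ∀ {A B : Set} c g (h : B → A) xs → maxOver c g (map h xs) ≡ maxOver (c ∘ h) (g ∘ h) xs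
maxOver-map c g h []       = refl
maxOver-map c g h (x ∷ xs) = cong (λ m → if c (h x) then g (h x) ⊔ m else m) (maxOver-map c g h xs)

Unique-index-lookup : ∀ {A : Set} {xs : List A} → Unique xs →
                      ∀ i (x∈ : List.lookup xs i ∈ xs) → Any.index x∈ ≡ i
Unique-index-lookup {xs = _ ∷ _} _         Fin.zero    (here _)   = refl
Unique-index-lookup {xs = _ ∷ _} (x∉ ∷ _) Fin.zero    (there x∈) = ⊥-elim (All.lookup x∉ x∈ refl)
Unique-index-lookup {xs = _ ∷ _} (x∉ ∷ _) (Fin.suc i) (here eq)   = ⊥-elim (All.lookup x∉ (∈-lookup i) (sym eq))
Unique-index-lookup {xs = _ ∷ _} (_ ∷ u)  (Fin.suc i) (there x∈) = cong Fin.suc (Unique-index-lookup u i x∈)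

tabulate-lookup-cast : ∀ {A : Set} (xs : List A) {m} (eq : m ≡ length xs) →
                       tabulate (λ i → List.lookup xs (cast eq i)) ≡ xs
tabulate-lookup-cast xs refl =
  trans (List.tabulate-cong (λ i → cong (List.lookup xs) (cast-is-id refl i))) (tabulate-lookup xs)

listPermutation : ∀ {d} (w : List (Fin d)) → Unique w → (∀ v → v ∈ w) → length w ≡ d →
                  Σ (Permutation′ d) λ π → tabulate (π ⟨$⟩ʳ_) ≡ w
listPermutation {d} w u complete len =
  permutation at position at∘position position∘at , tabulate-lookup-cast w (sym len)
  where
  at : Fin d → Fin d
  at i = List.lookup w (cast (sym len) i)
  position : Fin d → Fin d
  position v = cast len (Any.index (complete v))
  at∘position : ∀ v → at (position v) ≡ v
  at∘position v =
    trans (cong (List.lookup w) (cast-involutive (sym len) len _)) (sym (lookup-index (complete v)))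
  position∘at : ∀ i → position (at i) ≡ i
  position∘at i =
    trans (cong (cast len) (Unique-index-lookup u _ (complete (at i)))) (cast-involutive len (sym len) i)

x∈p─q⇒x∉q : ∀ {n} {p q : Subset n} {x} → x ∈ₛ p ─ q → x ∉ₛ q
x∈p─q⇒x∉q {p = _ ∷ _} {outside ∷ _} (Vec.there x∈p─q) (Vec.there x∈q) = x∈p─q⇒x∉q x∈p─q x∈q
x∈p─q⇒x∉q {p = _ ∷ _} {inside ∷ _}  (Vec.there x∈p─q) (Vec.there x∈q) = x∈p─q⇒x∉q x∈p─q x∈q

⊆∧≢⇒⊂ : ∀ {n} {p q : Subset n} → p ⊆ q → p ≢ q → p ⊂ q
⊆∧≢⇒⊂ {p = []}          {[]}          _   p≢q = ⊥-elim (p≢q refl)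
⊆∧≢⇒⊂ {p = outside ∷ p} {outside ∷ q} p⊆q p≢q = s⊂s (⊆∧≢⇒⊂ (drop-∷-⊆ p⊆q) (p≢q ∘ cong (outside ∷_)))
⊆∧≢⇒⊂ {p = inside ∷ p}  {inside ∷ q}  p⊆q p≢q = s⊂s (⊆∧≢⇒⊂ (drop-∷-⊆ p⊆q) (p≢q ∘ cong (inside ∷_)))
⊆∧≢⇒⊂ {p = outside ∷ p} {inside ∷ q}  p⊆q _   = out⊂in (drop-∷-⊆ p⊆q)
⊆∧≢⇒⊂ {p = inside ∷ p}  {outside ∷ q} p⊆q _   with p⊆q Vec.here
... | ()

p⊆q⇒p∪[q─p]≡q : ∀ {n} {p q : Subset n} → p ⊆ q → p ∪ (q ─ p) ≡ q
p⊆q⇒p∪[q─p]≡q {p = p} {q} p⊆q = ⊆-antisym (λ x∈ → [ p⊆q , p─q⊆p q p ]′ (x∈p∪q⁻ p (q ─ p) x∈)) q⊆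
  where
  q⊆ : q ⊆ p ∪ (q ─ p)
  q⊆ {x} x∈q with x ∈? p
  ... | yes x∈p = x∈p∪q⁺ (inj₁ x∈p)
  ... | no  x∉p = x∈p∪q⁺ (inj₂ (x∈p∧x∉q⇒x∈p─q x∈q x∉p))

[p∪q]─p≡q : ∀ {n} {p q : Subset n} → (∀ {x} → x ∈ₛ q → x ∉ₛ p) → (p ∪ q) ─ p ≡ q
[p∪q]─p≡q {p = p} {q} q∩p≡∅ = ⊆-antisym ⊆q (λ x∈q → x∈p∧x∉q⇒x∈p─q (q⊆p∪q p q x∈q) (q∩p≡∅ x∈q))
  where
  ⊆q : (p ∪ q) ─ p ⊆ q
  ⊆q x∈ = [ (λ x∈p → ⊥-elim (x∈p─q⇒x∉q x∈ x∈p)) , (λ x∈q → x∈q) ]′ (x∈p∪q⁻ p q (p─q⊆p (p ∪ q) p x∈))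

-- Run-length encoding

module RunLength {A : Set} (_≟_ : DecidableEquality A) where

  Positive : A × ℕ → Set
  Positive (_ , e) = 1 ≤ e

  push : A → List (A × ℕ) → List (A × ℕ)
  push x [] = [ (x , 1) ]
  push x ((y , e) ∷ ys) with x ≟ y
  ... | yes _ = (y , suc e) ∷ ys
  ... | no  _ = (x , 1) ∷ (y , e) ∷ ys

  runLengths : List A → List (A × ℕ)
  runLengths = foldr push []

  expand : List (A × ℕ) → List A
  expand []             = []
  expand ((x , e) ∷ ys) = replicate e x ++ expand ys

  expand-push : ∀ x ys → expand (push x ys) ≡ x ∷ expand ys
  expand-push x [] = refl
  expand-push x ((y , e) ∷ ys) with x ≟ y
  ... | yes refl = refl
  ... | no  _    = refl

  expand-runLengths : ∀ xs → expand (runLengths xs) ≡ xs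
  expand-runLengths []       = refl
  expand-runLengths (x ∷ xs) = trans (expand-push x (runLengths xs)) (cong (x ∷_) (expand-runLengths xs))

  runLengths-∷ : ∀ x xs → ∃₂ λ e ys → runLengths (x ∷ xs) ≡ (x , e) ∷ ys
  runLengths-∷ x xs with runLengths xs
  ... | [] = _ , _ , refl
  ... | (y , e) ∷ ys with x ≟ y
  ...   | yes refl = _ , _ , refl
  ...   | no  _    = _ , _ , refl

  relabel : ∀ {S : A → A → Set} {x} {e e′ : ℕ} {ys} →
            Linked (S on proj₁) ((x , e) ∷ ys) → Linked (S on proj₁) ((x , e′) ∷ ys)
  relabel [-]     = [-]
  relabel (r ∷ l) = r ∷ l

  module _ {R : A → A → Set} where

    runLengths-Linked : ∀ {xs} → Linked R xs → Linked ((λ x y → R x y × x ≢ y) on proj₁) (runLengths xs)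
    runLengths-Linked []            = []
    runLengths-Linked [-]           = [-]
    runLengths-Linked {x ∷ y ∷ xs} (xRy ∷ l) with runLengths-∷ y xs | runLengths-Linked l
    ... | e , ys , eq | l′ rewrite eq with x ≟ y
    ...   | yes refl = relabel l′
    ...   | no  x≢y  = (xRy , x≢y) ∷ l′

    module _ (R-refl : Reflexive R) where

      replicate-Linked : ∀ {x zs} k → Linked R (x ∷ zs) → Linked R (x ∷ replicate k x ++ zs)
      replicate-Linked zero    l = l
      replicate-Linked (suc k) l = R-refl ∷ replicate-Linked k l

      ∷-expand-Linked : ∀ {x e ys} → Linked (R on proj₁) ((x , e) ∷ ys) → All Positive ys →
                        Linked R (x ∷ expand ys)
      ∷-expand-Linked [-]                                 []        = [-]
      ∷-expand-Linked {ys = (_ , suc e) ∷ _} (xRy ∷ l) (_ ∷ pos) =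
        xRy ∷ replicate-Linked e (∷-expand-Linked l pos)

      expand-Linked : ∀ {ys} → Linked (R on proj₁) ys → All Positive ys → Linked R (expand ys)
      expand-Linked []                                   []        = []
      expand-Linked {(_ , suc e) ∷ _} l (_ ∷ pos) = replicate-Linked e (∷-expand-Linked l pos)

  runLengths-positive : ∀ xs → All Positive (runLengths xs)
  runLengths-positive []       = []
  runLengths-positive (x ∷ xs) = push-positive x (runLengths-positive xs)
    where
    push-positive : ∀ x {ys} → All Positive ys → All Positive (push x ys)
    push-positive x {[]} [] = s≤s z≤n ∷ []
    push-positive x {(y , e) ∷ ys} (p ∷ ps) with x ≟ y
    ... | yes _ = s≤s z≤n ∷ ps
    ... | no  _ = s≤s z≤n ∷ p ∷ ps

  push-fresh : ∀ {x e ys} → Linked (_≢_ on proj₁) ((x , e) ∷ ys) → push x ys ≡ (x , 1) ∷ ys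
  push-fresh [-] = refl
  push-fresh {x} {ys = (y , _) ∷ _} (x≢y ∷ _) with x ≟ y
  ... | yes x≡y = ⊥-elim (x≢y x≡y)
  ... | no  _   = refl

  push-same : ∀ x e ys → push x ((x , e) ∷ ys) ≡ (x , suc e) ∷ ys
  push-same x e ys with x ≟ x
  ... | yes _   = refl
  ... | no  x≢x = ⊥-elim (x≢x refl)

  runLengths-expand : ∀ {ys} → Linked (_≢_ on proj₁) ys → All Positive ys → runLengths (expand ys) ≡ ys
  runLengths-expand [] [] = refl
  runLengths-expand {(x , suc e) ∷ ys} l (_ ∷ pos) = run e
    where
    run : ∀ k → runLengths (replicate (suc k) x ++ expand ys) ≡ (x , suc k) ∷ ys
    run zero    = trans (cong (push x) (runLengths-expand (Linked.tail l) pos)) (push-fresh l)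
    run (suc k) = trans (cong (push x) (run k)) (push-same x (suc k) ys)

  length-expand : ∀ ys → length (expand ys) ≡ foldr _+_ 0 (map proj₂ ys)
  length-expand []             = refl
  length-expand ((x , e) ∷ ys) =
    trans (length-++ (replicate e x)) (cong₂ _+_ (length-replicate e) (length-expand ys))

  ∈-expand⁻ : ∀ {x} ys → x ∈ expand ys → x ∈ map proj₁ ys
  ∈-expand⁻ ((y , e) ∷ ys) x∈ with ∈-++⁻ (replicate e y) x∈
  ... | inj₁ x∈rep = here (All.lookup (All.replicate⁺ {P = _≡ y} e refl) x∈rep)
  ... | inj₂ x∈ys  = there (∈-expand⁻ ys x∈ys)

  ∈-expand⁺ : ∀ {x ys} → All Positive ys → x ∈ map proj₁ ys → x ∈ expand ys
  ∈-expand⁺ {ys = (y , suc e) ∷ ys} _         (here x≡y)  = here x≡y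
  ∈-expand⁺ {ys = (y , e) ∷ ys}     (_ ∷ pos) (there x∈ys) = ∈-++⁺ʳ (replicate e y) (∈-expand⁺ pos x∈ys)

-- Chains of level sets

module _ {d : ℕ} where

  Chain : List (Subset d) → Set
  Chain = Linked _⊆_

  rank : List (Subset d) → Fin d → ℕ
  rank []      x = 0
  rank (S ∷ L) x with x ∈? S
  ... | yes _ = 0
  ... | no  _ = suc (rank L x)

  rank-≤-length : ∀ L x → rank L x ≤ length L
  rank-≤-length []      x = z≤n
  rank-≤-length (S ∷ L) x with x ∈? S
  ... | yes _ = z≤n
  ... | no  _ = s≤s (rank-≤-length L x)

  Chain-head-⊆ : ∀ {S T L} → Chain (S ∷ L) → T ∈ L → S ⊆ T
  Chain-head-⊆ chain T∈L with Linked⇒AllPairs ⊆-trans chain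
  ... | S⊆L ∷ _ = All.lookup S⊆L T∈L

  rank-separates : ∀ {L S x y} → Chain L → S ∈ L → x ∈ₛ S → y ∉ₛ S → rank L x < rank L y
  rank-separates {T ∷ L} {x = x} {y} chain (here refl) x∈T y∉T with x ∈? T | y ∈? T
  ... | yes _  | no _    = s≤s z≤n
  ... | no x∉T | _       = ⊥-elim (x∉T x∈T)
  ... | yes _  | yes y∈T = ⊥-elim (y∉T y∈T)
  rank-separates {T ∷ L} {x = x} {y} chain (there S∈L) x∈S y∉S with x ∈? T | y ∈? T
  ... | _     | yes y∈T = ⊥-elim (y∉S (Chain-head-⊆ chain S∈L y∈T))
  ... | yes _ | no _    = s≤s z≤n
  ... | no _  | no _    = s≤s (rank-separates (Linked.tail chain) S∈L x∈S y∉S)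

  zeroSet : (Fin d → ℕ) → Subset d
  zeroSet f = Vec.tabulate (λ x → f x ≡ᵇ 0)

  ∈-zeroSet⁺ : ∀ f {x} → f x ≡ 0 → x ∈ₛ zeroSet f
  ∈-zeroSet⁺ f {x} fx≡0 = lookup⇒[]= x _ (trans (lookup∘tabulate _ x) (cong (_≡ᵇ 0) fx≡0))

  ∈-zeroSet⁻ : ∀ f {x} → x ∈ₛ zeroSet f → f x ≡ 0
  ∈-zeroSet⁻ f {x} x∈ with f x | trans (sym (lookup∘tabulate (λ x → f x ≡ᵇ 0) x)) ([]=⇒lookup x∈)
  ... | zero | _ = refl

  levelSets : ℕ → (Fin d → ℕ) → List (Subset d)
  levelSets zero    f = []
  levelSets (suc n) f = zeroSet f ∷ levelSets n (pred ∘ f)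

  length-levelSets : ∀ n f → length (levelSets n f) ≡ n
  length-levelSets zero    f = refl
  length-levelSets (suc n) f = cong suc (length-levelSets n (pred ∘ f))

  levelSets-cong : ∀ n {f g} → (∀ x → f x ≡ g x) → levelSets n f ≡ levelSets n g
  levelSets-cong zero    f≗g = refl
  levelSets-cong (suc n) f≗g =
    cong₂ _∷_ (tabulate-cong (λ x → cong (_≡ᵇ 0) (f≗g x))) (levelSets-cong n (λ x → cong pred (f≗g x)))

  levelSets-Chain : ∀ n f → Chain (levelSets n f)
  levelSets-Chain zero          f = []
  levelSets-Chain (suc zero)    f = [-]
  levelSets-Chain (suc (suc n)) f =
    (λ x∈ → ∈-zeroSet⁺ (pred ∘ f) (cong pred (∈-zeroSet⁻ f x∈))) ∷ levelSets-Chain (suc n) (pred ∘ f)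

  rank-levelSets : ∀ n f x → f x ≤ n → rank (levelSets n f) x ≡ f x
  rank-levelSets zero    f x fx≤0 with f x | fx≤0
  ... | zero | _ = refl
  rank-levelSets (suc n) f x fx≤n with x ∈? zeroSet f
  ... | yes x∈ = sym (∈-zeroSet⁻ f x∈)
  ... | no  x∉ with f x in eq | rank-levelSets n (pred ∘ f) x
  ...   | zero  | _  = ⊥-elim (x∉ (∈-zeroSet⁺ f eq))
  ...   | suc k | ih = cong suc (ih (pred-mono-≤ fx≤n))

  rank-∈-head : ∀ {S L x} → x ∈ₛ S → rank (S ∷ L) x ≡ 0
  rank-∈-head {S} {x = x} x∈S with x ∈? S
  ... | yes _   = refl
  ... | no  x∉S = ⊥-elim (x∉S x∈S)

  pred-rank-∷ : ∀ {S L} → Chain (S ∷ L) → ∀ x → pred (rank (S ∷ L) x) ≡ rank L x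
  pred-rank-∷ {S} chain x with x ∈? S
  pred-rank-∷ _                        x | no  _   = refl
  pred-rank-∷ {L = []}    _            x | yes _   = refl
  pred-rank-∷ {L = T ∷ L} (S⊆T ∷ _) x | yes x∈S = sym (rank-∈-head (S⊆T x∈S))

  levelSets-rank : ∀ {L} → Chain L → levelSets (length L) (rank L) ≡ L
  levelSets-rank {[]}    _     = refl
  levelSets-rank {S ∷ L} chain =
    cong₂ _∷_ (⊆-antisym zeroSet⊆S (∈-zeroSet⁺ (rank (S ∷ L)) ∘ rank-∈-head))
              (trans (levelSets-cong (length L) (pred-rank-∷ chain)) (levelSets-rank (Linked.tail chain)))
    where
    zeroSet⊆S : zeroSet (rank (S ∷ L)) ⊆ S
    zeroSet⊆S {x} x∈ with x ∈? S | ∈-zeroSet⁻ (rank (S ∷ L)) x∈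
    ... | yes x∈S | _ = x∈S

  ∈-levelSets : ∀ {n f S} i → i < n → (∀ {x} → x ∈ₛ S → f x ≤ i) → (∀ {x} → f x ≤ i → x ∈ₛ S) →
                S ∈ levelSets n f
  ∈-levelSets {suc n} {f} zero    _ S⊆ ⊆S =
    here (⊆-antisym (λ x∈S → ∈-zeroSet⁺ f (n≤0⇒n≡0 (S⊆ x∈S))) (λ x∈ → ⊆S (≤-reflexive (∈-zeroSet⁻ f x∈))))
  ∈-levelSets {suc n} {f} (suc i) (s≤s i<n) S⊆ ⊆S =
    there (∈-levelSets i i<n (λ x∈S → pred-mono-≤ (S⊆ x∈S)) (λ {x} le → ⊆S (unpred (f x) le)))
    where
    unpred : ∀ m → pred m ≤ i → m ≤ suc i
    unpred zero    _  = z≤n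
    unpred (suc m) le = s≤s le

module _ {d : ℕ} where

  keys : List (Fin d × ℕ) → List (Fin d)
  keys = map proj₁

  partialUnions : Subset d → List (Subset d) → List (Subset d)
  partialUnions A []       = []
  partialUnions A (D ∷ Ds) = (A ∪ D) ∷ partialUnions (A ∪ D) Ds

  partialUnions-diffs : ∀ {A Bs} → Chain (A ∷ Bs) → partialUnions A (diffs A Bs) ≡ Bs
  partialUnions-diffs {Bs = []}    _              = refl
  partialUnions-diffs {A} {B ∷ Bs} (A⊆B ∷ chain) rewrite p⊆q⇒p∪[q─p]≡q A⊆B =
    cong (B ∷_) (partialUnions-diffs chain)

  data Fresh : Subset d → List (Subset d) → Set where
    []  : ∀ {A} → Fresh A []
    _∷_ : ∀ {A D Ds} → Nonempty D × (∀ {x} → x ∈ₛ D → x ∉ₛ A) → Fresh (A ∪ D) Ds → Fresh A (D ∷ Ds)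

  diffs-partialUnions : ∀ {A Ds} → Fresh A Ds → diffs A (partialUnions A Ds) ≡ Ds
  diffs-partialUnions []                   = refl
  diffs-partialUnions ((_ , D∩A≡∅) ∷ fresh) = cong₂ _∷_ ([p∪q]─p≡q D∩A≡∅) (diffs-partialUnions fresh)

  Fresh-dropLast : ∀ {A Ds} → Fresh A Ds → Fresh A (dropLast Ds)
  Fresh-dropLast []                   = []
  Fresh-dropLast (_ ∷ [])             = []
  Fresh-dropLast (D ∷ fresh@(_ ∷ _)) = D ∷ Fresh-dropLast fresh

  partialUnions-⊂ : ∀ {A D Ds} → Fresh A (D ∷ Ds) →
                    Linked _⊂_ (A ∷ partialUnions A (dropLast (D ∷ Ds)) ++ [ ⊤ ])
  partialUnions-⊂ (((x , x∈D) , D∩A≡∅) ∷ [])              = (⊆⊤ , x , ∈⊤ , D∩A≡∅ x∈D) ∷ [-]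
  partialUnions-⊂ (((x , x∈D) , D∩A≡∅) ∷ fresh@(_ ∷ _)) =
    (p⊆p∪q _ , x , x∈p∪q⁺ (inj₂ x∈D) , D∩A≡∅ x∈D) ∷ partialUnions-⊂ fresh

  Fresh⇒basic : ∀ {Es : List (Subset d)} → Fresh ⊥ Es → (∃₂ λ S Ss → Es ≡ S ∷ Ss) →
                Linked _⊂_ (⊥ ∷ partialUnions ⊥ (dropLast Es) ++ [ ⊤ ]) ×
                dropLast Es ≡ diffs ⊥ (partialUnions ⊥ (dropLast Es))
  Fresh⇒basic fresh (_ , _ , refl) = partialUnions-⊂ fresh , sym (diffs-partialUnions (Fresh-dropLast fresh))

-- The labelling ℓ, cuts, and the basic monomial of a permutation

module _ {d : ℕ} (G : Graph d) where

  keys-withℓ-aux : ∀ prev vs → keys (withℓ-aux G prev vs) ≡ keys prev ++ vs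
  keys-withℓ-aux prev []       = sym (++-identityʳ (keys prev))
  keys-withℓ-aux prev (v ∷ vs) = begin
    keys (withℓ-aux G (prev ++ [ (v , ℓnext G prev v) ]) vs) ≡⟨ keys-withℓ-aux _ vs ⟩
    keys (prev ++ [ (v , ℓnext G prev v) ]) ++ vs           ≡⟨ cong (_++ vs) (map-++ proj₁ prev _) ⟩
    (keys prev ++ [ v ]) ++ vs                              ≡⟨ ++-assoc (keys prev) [ v ] vs ⟩
    keys prev ++ v ∷ vs                                     ∎
    where open ≡-Reasoning

  keys-withℓ : ∀ w → keys (withℓ G w) ≡ w
  keys-withℓ = keys-withℓ-aux []

  EdgeIncreasing : Fin d × ℕ → Fin d × ℕ → Set
  EdgeIncreasing (u , l) (v , m) = adj G u v ≡ true → l < m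

  withℓ-aux-increasing : ∀ prev vs → AllPairs EdgeIncreasing prev →
                         AllPairs EdgeIncreasing (withℓ-aux G prev vs)
  withℓ-aux-increasing prev []       inc = inc
  withℓ-aux-increasing prev (v ∷ vs) inc =
    withℓ-aux-increasing _ vs (AllPairs.++⁺ inc ([] ∷ []) (All.tabulate (λ p∈ → below p∈ ∷ [])))
    where
    -- ℓnext G prev v unfolds to maxOver (λ p → adj G (proj₁ p) v) (suc ∘ proj₂) prev.
    below : ∀ {p} → p ∈ prev → EdgeIncreasing p (v , ℓnext G prev v)
    below p∈ = maxOver-upper (λ p → adj G (proj₁ p) v) (suc ∘ proj₂) prev p∈

  withℓ-increasing : ∀ w → AllPairs EdgeIncreasing (withℓ G w)
  withℓ-increasing w = withℓ-aux-increasing [] w []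

  withℓ-labels : ∀ (L : Fin d → ℕ) w →
                 (∀ pre v post → pre ++ v ∷ post ≡ w → ℓnext G (map (λ u → u , L u) pre) v ≡ L v) →
                 withℓ G w ≡ map (λ u → u , L u) w
  withℓ-labels L w recursion = labels [] w refl
    where
    label : Fin d → Fin d × ℕ
    label u = u , L u
    labels : ∀ pre rest → pre ++ rest ≡ w → withℓ-aux G (map label pre) rest ≡ map label w
    labels pre []         eq = cong (map label) (trans (sym (++-identityʳ pre)) eq)
    labels pre (v ∷ rest) eq = begin
      withℓ-aux G (map label pre ++ [ (v , ℓnext G (map label pre) v) ]) rest
        ≡⟨ cong (λ l → withℓ-aux G (map label pre ++ [ (v , l) ]) rest) (recursion pre v rest eq) ⟩
      withℓ-aux G (map label pre ++ map label [ v ]) rest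
        ≡⟨ cong (λ p → withℓ-aux G p rest) (map-++ label pre [ v ]) ⟨
      withℓ-aux G (map label (pre ++ [ v ])) rest
        ≡⟨ labels (pre ++ [ v ]) rest (trans (++-assoc pre [ v ] rest) eq) ⟩
      map label w
        ∎
      where open ≡-Reasoning

  isCut-< : ∀ {q r} → proj₂ q < proj₂ r → isCut G q r ≡ true
  isCut-< {a , l} {b , m} q<r = to T-≡ (from (T-∨ {l <ᵇ m}) (inj₁ (<⇒<ᵇ q<r)))

  isCut⁻ : ∀ {q r} → isCut G q r ≡ true →
           proj₂ q < proj₂ r ⊎ (proj₂ q ≡ proj₂ r × toℕ (proj₁ q) < toℕ (proj₁ r))
  isCut⁻ {a , l} {b , m} cut =
    Sum.map (<ᵇ⇒< l m) (λ t → let (l≡m , a<b) = to T-∧ t in ≡ᵇ⇒≡ l m l≡m , <ᵇ⇒< (toℕ a) (toℕ b) a<b)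
            (to T-∨ (from T-≡ cut))

  ¬isCut⇒≥ : ∀ {q r} → isCut G q r ≡ false → proj₂ r ≤ proj₂ q
  ¬isCut⇒≥ {q} {r} ¬cut = ≮⇒≥ (λ q<r → case trans (sym (isCut-< {q} {r} q<r)) ¬cut of λ ())

  -- The segments m of rs for which q ∷ rs has a cut right after q ∷ m.
  cutsFrom : Fin d × ℕ → List (Fin d × ℕ) → List (List (Fin d × ℕ))
  cutsFrom q []       = []
  cutsFrom q (r ∷ rs) = if isCut G q r then [] ∷ later else later
    where later = map (r ∷_) (cutsFrom r rs)

  ∈-cutsFrom-∷ : ∀ {q r rs m} → m ∈ cutsFrom r rs → r ∷ m ∈ cutsFrom q (r ∷ rs)
  ∈-cutsFrom-∷ {q} {r} m∈ with isCut G q r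
  ... | true  = there (∈-map⁺ (r ∷_) m∈)
  ... | false = ∈-map⁺ (r ∷_) m∈

  CutPrefix : List (Fin d × ℕ) → List (Fin d × ℕ) → Set
  CutPrefix ws p = ∃ λ pre → ∃ λ q → ∃₂ λ r post →
    ws ≡ pre ++ q ∷ r ∷ post × p ≡ pre ++ [ q ] × isCut G q r ≡ true

  CutPrefix-∷ : ∀ {ws p} q → CutPrefix ws p → CutPrefix (q ∷ ws) (q ∷ p)
  CutPrefix-∷ q (pre , q′ , r , post , ws≡ , p≡ , cut) =
    q ∷ pre , q′ , r , post , cong (q ∷_) ws≡ , cong (q ∷_) p≡ , cut

  cutsFrom-sound : ∀ {q rs m} → m ∈ cutsFrom q rs → CutPrefix (q ∷ rs) (q ∷ m)
  cutsFrom-sound {q} {r ∷ rs} m∈ with isCut G q r in cut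
  cutsFrom-sound {q} {r ∷ rs} (here refl) | true = [] , q , r , rs , refl , refl , cut
  cutsFrom-sound {q} {r ∷ rs} (there m∈)  | true with ∈-map⁻ (r ∷_) m∈
  ... | m , m∈′ , refl = CutPrefix-∷ q (cutsFrom-sound m∈′)
  cutsFrom-sound {q} {r ∷ rs} m∈          | false with ∈-map⁻ (r ∷_) m∈
  ... | m , m∈′ , refl = CutPrefix-∷ q (cutsFrom-sound m∈′)

  cutsFrom-excluding : ∀ q rs {p} → Unique (keys (q ∷ rs)) → p ∈ rs → proj₂ q < proj₂ p →
              ∃ λ m → m ∈ cutsFrom q rs × proj₁ p ∉ keys (q ∷ m)
  cutsFrom-excluding q (r ∷ rs) u p∈ q<p with isCut G q r in cut
  cutsFrom-excluding q (r ∷ rs) u p∈ q<p | true =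
    [] , here refl , λ { (here p≡q) → Unique-∷⇒∉ u (∈-map⁺ proj₁ p∈) p≡q }
  cutsFrom-excluding q (r ∷ rs) u (here refl) q<p | false = ⊥-elim (<⇒≱ q<p (¬isCut⇒≥ {q} {r} cut))
  cutsFrom-excluding q (r ∷ rs) u (there p∈) q<p | false
    with cutsFrom-excluding r rs (AllPairs.tail u) p∈ (≤-<-trans (¬isCut⇒≥ {q} {r} cut) q<p)
  ... | m , m∈ , p∉ = r ∷ m , ∈-map⁺ (r ∷_) m∈ ,
    λ { (here p≡q) → Unique-∷⇒∉ u (there (∈-map⁺ proj₁ p∈)) p≡q ; (there p∈′) → p∉ p∈′ }

  SeparatedBy : List (Fin d) → Fin d → Fin d → Set
  SeparatedBy xs x y = (x ∈ xs × y ∉ xs) ⊎ (y ∈ xs × x ∉ xs)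

  cutsFrom-separating : ∀ q rs {x y} → AllPairs EdgeIncreasing (q ∷ rs) → Unique (keys (q ∷ rs)) →
                 x ∈ keys (q ∷ rs) → y ∈ keys (q ∷ rs) → adj G x y ≡ true →
                 ∃ λ m → m ∈ cutsFrom q rs × SeparatedBy (keys (q ∷ m)) x y
  cutsFrom-separating q rs         inc u (here refl)  (here refl)  xy =
    case trans (sym xy) (loopless G _) of λ ()
  cutsFrom-separating q rs         inc u (here refl)  (there y∈)  xy with ∈-map⁻ proj₁ y∈
  ... | p , p∈ , refl with cutsFrom-excluding q rs u p∈ (All.lookup (AllPairs.head inc) p∈ xy)
  ...   | m , m∈ , p∉ = m , m∈ , inj₁ (here refl , p∉)
  cutsFrom-separating q rs         inc u (there x∈)  (here refl)  xy with ∈-map⁻ proj₁ x∈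
  ... | p , p∈ , refl
    with cutsFrom-excluding q rs u p∈ (All.lookup (AllPairs.head inc) p∈ (trans (adj-sym G _ _) xy))
  ...   | m , m∈ , p∉ = m , m∈ , inj₂ (here refl , p∉)
  cutsFrom-separating q (r ∷ rs) inc u (there x∈) (there y∈) xy
    with cutsFrom-separating r rs (AllPairs.tail inc) (AllPairs.tail u) x∈ y∈ xy
  ... | m , m∈ , sep = r ∷ m , ∈-cutsFrom-∷ {rs = rs} m∈ , Sum.map (extend x∈ y∈) (extend y∈ x∈) sep
    where
    extend : ∀ {a b} → a ∈ keys (r ∷ rs) → b ∈ keys (r ∷ rs) →
             a ∈ keys (r ∷ m) × b ∉ keys (r ∷ m) → a ∈ keys (q ∷ r ∷ m) × b ∉ keys (q ∷ r ∷ m)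
    extend a∈ b∈ (a∈m , b∉m) = there a∈m , λ { (here b≡q) → Unique-∷⇒∉ u b∈ b≡q ; (there b∈m) → b∉m b∈m }

  cutSets : List (Fin d × ℕ) → List (Subset d)
  cutSets []       = []
  cutSets (q ∷ rs) = map (λ m → toSubset G (keys (q ∷ m))) (cutsFrom q rs)

  ∈-cutSets⁻ : ∀ {ws S} → S ∈ cutSets ws → ∃ λ p → CutPrefix ws p × S ≡ toSubset G (keys p)
  ∈-cutSets⁻ {q ∷ rs} S∈ with ∈-map⁻ _ S∈
  ... | m , m∈ , refl = q ∷ m , cutsFrom-sound m∈ , refl

  ∈-toSubset⁺ : ∀ {x xs} → x ∈ xs → x ∈ₛ toSubset G xs
  ∈-toSubset⁺ (here refl) = x∈p∪q⁺ (inj₁ (x∈⁅x⁆ _))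
  ∈-toSubset⁺ (there x∈)  = x∈p∪q⁺ (inj₂ (∈-toSubset⁺ x∈))

  ∈-toSubset⁻ : ∀ {x} xs → x ∈ₛ toSubset G xs → x ∈ xs
  ∈-toSubset⁻ []       x∈ = ⊥-elim (∉⊥ x∈)
  ∈-toSubset⁻ (y ∷ ys) x∈ with x∈p∪q⁻ ⁅ y ⁆ (toSubset G ys) x∈
  ... | inj₁ x∈y  = here (x∈⁅y⁆⇒x≡y y x∈y)
  ... | inj₂ x∈ys = there (∈-toSubset⁻ ys x∈ys)

  ∈-cutSets-labelled⁻ : ∀ (L : Fin d → ℕ) {w S} → S ∈ cutSets (map (λ u → u , L u) w) →
                        ∃ λ pre → ∃ λ a → ∃₂ λ b post →
                        w ≡ pre ++ a ∷ b ∷ post × S ≡ toSubset G (pre ++ [ a ]) ×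
                        isCut G (a , L a) (b , L b) ≡ true
  ∈-cutSets-labelled⁻ L {w} S∈ with ∈-cutSets⁻ S∈
  ... | _ , (pre , q , r , post , ws≡ , refl , cut) , refl =
    keys pre , proj₁ q , proj₁ r , keys post , split , cong (toSubset G) (map-++ proj₁ pre [ q ]) ,
    subst₂ (λ q′ r′ → isCut G q′ r′ ≡ true)
           (labelled (∈-++⁺ʳ pre (here refl))) (labelled (∈-++⁺ʳ pre (there (here refl)))) cut
    where
    split : w ≡ keys pre ++ proj₁ q ∷ proj₁ r ∷ keys post
    split = begin
      w                                ≡⟨ map-id w ⟨
      map (proj₁ ∘ λ u → u , L u) w    ≡⟨ map-∘ w ⟩
      keys (map (λ u → u , L u) w)     ≡⟨ cong keys ws≡ ⟩
      keys (pre ++ q ∷ r ∷ post)       ≡⟨ map-++ proj₁ pre (q ∷ r ∷ post) ⟩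
      keys pre ++ proj₁ q ∷ proj₁ r ∷ keys post ∎
      where open ≡-Reasoning
    labelled : ∀ {p} → p ∈ pre ++ q ∷ r ∷ post → p ≡ (proj₁ p , L (proj₁ p))
    labelled p∈ with ∈-map⁻ _ (subst (_ ∈_) (sym ws≡) p∈)
    ... | _ , _ , refl = refl

  map-blocksFrom-∷ : ∀ q cur rs → ∃₂ λ S Ss → map (toSubset G) (blocksFrom G q cur rs) ≡ S ∷ Ss
  map-blocksFrom-∷ q cur []       = _ , _ , refl
  map-blocksFrom-∷ q cur (r ∷ rs) with isCut G q r
  ... | true  = _ , _ , refl
  ... | false = map-blocksFrom-∷ r (proj₁ r ∷ cur) rs

  partialUnions-blocksFrom : ∀ A q cur rs →
    partialUnions A (dropLast (map (toSubset G) (blocksFrom G q cur rs))) ≡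
    map (λ m → (A ∪ toSubset G cur) ∪ toSubset G (keys m)) (cutsFrom q rs)
  partialUnions-blocksFrom A q cur []       = refl
  partialUnions-blocksFrom A q cur (r ∷ rs) with isCut G q r
  ... | true = begin
    partialUnions A (dropLast (C ∷ map (toSubset G) (blocksFrom G r [ proj₁ r ] rs)))
      ≡⟨ cong (partialUnions A) (dropLast-∷ C (map-blocksFrom-∷ r [ proj₁ r ] rs)) ⟩
    X ∷ partialUnions X (dropLast (map (toSubset G) (blocksFrom G r [ proj₁ r ] rs)))
      ≡⟨ cong (X ∷_) (partialUnions-blocksFrom X r [ proj₁ r ] rs) ⟩
    X ∷ map (λ m → (X ∪ (⁅ proj₁ r ⁆ ∪ ⊥)) ∪ toSubset G (keys m)) (cutsFrom r rs)
      ≡⟨ cong₂ _∷_ (sym (∪-identityʳ X)) (trans (sym (map-cong step (cutsFrom r rs))) (map-∘ (cutsFrom r rs))) ⟩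
    map F ([] ∷ map (r ∷_) (cutsFrom r rs))
      ∎
    where
    open ≡-Reasoning
    C = toSubset G cur
    X = A ∪ C
    F = λ m → X ∪ toSubset G (keys m)
    step : ∀ m → F (r ∷ m) ≡ (X ∪ (⁅ proj₁ r ⁆ ∪ ⊥)) ∪ toSubset G (keys m)
    step m = begin
      X ∪ (⁅ proj₁ r ⁆ ∪ K)         ≡⟨ ∪-assoc X ⁅ proj₁ r ⁆ K ⟨
      (X ∪ ⁅ proj₁ r ⁆) ∪ K         ≡⟨ cong (λ Y → (X ∪ Y) ∪ K) (∪-identityʳ ⁅ proj₁ r ⁆) ⟨
      (X ∪ (⁅ proj₁ r ⁆ ∪ ⊥)) ∪ K   ∎
      where K = toSubset G (keys m)
  ... | false = trans (partialUnions-blocksFrom A r (proj₁ r ∷ cur) rs)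
                      (trans (map-cong step (cutsFrom r rs)) (map-∘ (cutsFrom r rs)))
    where
    C = toSubset G cur
    R = ⁅ proj₁ r ⁆
    step : ∀ m → (A ∪ (R ∪ C)) ∪ toSubset G (keys m) ≡ (A ∪ C) ∪ (R ∪ toSubset G (keys m))
    step m = begin
      (A ∪ (R ∪ C)) ∪ K   ≡⟨ cong (λ Y → (A ∪ Y) ∪ K) (∪-comm R C) ⟩
      (A ∪ (C ∪ R)) ∪ K   ≡⟨ cong (_∪ K) (∪-assoc A C R) ⟨
      ((A ∪ C) ∪ R) ∪ K   ≡⟨ ∪-assoc (A ∪ C) R K ⟩
      (A ∪ C) ∪ (R ∪ K)   ∎
      where
      open ≡-Reasoning
      K = toSubset G (keys m)

  partialUnions-blocks : ∀ ws → partialUnions ⊥ (dropLast (map (toSubset G) (blocks G ws))) ≡ cutSets ws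
  partialUnions-blocks []       = refl
  partialUnions-blocks (q ∷ rs) =
    trans (partialUnions-blocksFrom ⊥ q [ proj₁ q ] rs)
          (map-cong (λ m → cong (_∪ toSubset G (keys m)) (trans (∪-identityˡ _) (∪-identityʳ _)))
                    (cutsFrom q rs))

  blocksFrom-Fresh : ∀ {A} q cur rs → (∃ λ z → z ∈ cur) → (∀ {z} → z ∈ cur → z ∉ₛ A) → Unique (keys rs) →
                     (∀ {z} → z ∈ keys rs → z ∉ₛ A × z ∉ cur) →
                     Fresh A (map (toSubset G) (blocksFrom G q cur rs))
  blocksFrom-Fresh {A} q cur rs (z , z∈cur) cur∉A u rs∉ = go rs u rs∉
    where
    head : Nonempty (toSubset G cur) × (∀ {x} → x ∈ₛ toSubset G cur → x ∉ₛ A)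
    head = (z , ∈-toSubset⁺ z∈cur) , (λ x∈ → cur∉A (∈-toSubset⁻ cur x∈))
    go : ∀ rs → Unique (keys rs) → (∀ {z} → z ∈ keys rs → z ∉ₛ A × z ∉ cur) →
         Fresh A (map (toSubset G) (blocksFrom G q cur rs))
    go []       _           _   = head ∷ []
    go (r ∷ rs) (r∉rs ∷ u) rs∉ with isCut G q r
    ... | true  = head ∷ blocksFrom-Fresh r [ proj₁ r ] rs (proj₁ r , here refl) r∉ u rs′∉
      where
      ∉∪ : ∀ {x} → x ∉ₛ A × x ∉ cur → x ∉ₛ A ∪ toSubset G cur
      ∉∪ (x∉A , x∉cur) x∈ = [ x∉A , x∉cur ∘ ∈-toSubset⁻ cur ]′ (x∈p∪q⁻ A _ x∈)
      r∉ : ∀ {x} → x ∈ [ proj₁ r ] → x ∉ₛ A ∪ toSubset G cur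
      r∉ (here refl) = ∉∪ (rs∉ (here refl))
      rs′∉ : ∀ {x} → x ∈ keys rs → x ∉ₛ A ∪ toSubset G cur × x ∉ [ proj₁ r ]
      rs′∉ x∈ = ∉∪ (rs∉ (there x∈)) , λ { (here x≡r) → All.lookup r∉rs x∈ (sym x≡r) }
    ... | false = blocksFrom-Fresh r (proj₁ r ∷ cur) rs (proj₁ r , here refl) r∷cur∉A u rs′∉
      where
      r∷cur∉A : ∀ {x} → x ∈ proj₁ r ∷ cur → x ∉ₛ A
      r∷cur∉A (here refl) = proj₁ (rs∉ (here refl))
      r∷cur∉A (there x∈)  = cur∉A x∈
      rs′∉ : ∀ {x} → x ∈ keys rs → x ∉ₛ A × x ∉ proj₁ r ∷ cur
      rs′∉ x∈ = proj₁ (rs∉ (there x∈)) ,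
        λ { (here x≡r) → All.lookup r∉rs x∈ (sym x≡r) ; (there x∈cur) → proj₂ (rs∉ (there x∈)) x∈cur }

  blocks-Fresh : ∀ ws → Unique (keys ws) → Fresh ⊥ (map (toSubset G) (blocks G ws))
  blocks-Fresh []       _          = []
  blocks-Fresh (q ∷ rs) (q∉ ∷ u) =
    blocksFrom-Fresh q [ proj₁ q ] rs (proj₁ q , here refl) (λ _ → ∉⊥) u
      (λ x∈ → ∉⊥ , λ { (here x≡q) → All.lookup q∉ x∈ (sym x≡q) })

  word-Unique : ∀ π → Unique (word G π)
  word-Unique π = Unique.tabulate⁺ λ {i} {j} πi≡πj →
    trans (sym (inverseˡ π)) (trans (cong (π ⟨$⟩ˡ_) πi≡πj) (inverseˡ π))

  ∈-word : ∀ π x → x ∈ word G π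
  ∈-word π x = subst (_∈ word G π) (inverseʳ π) (∈-tabulate⁺ (π ⟨$⟩ˡ x))

  basicChain : Permutation′ d → List (Subset d)
  basicChain π = partialUnions ⊥ (shortGSeq G π)

  basicChain-cutSets : ∀ π → basicChain π ≡ cutSets (withℓ G (word G π))
  basicChain-cutSets π = partialUnions-blocks (withℓ G (word G π))

  GSeq-∷ : 1 ≤ d → ∀ π → ∃₂ λ S Ss → GSeq G π ≡ S ∷ Ss
  GSeq-∷ (s≤s _) π with withℓ G (word G π) | keys-withℓ (word G π)
  ... | []     | []≡word = ⊥-elim (¬Any[] (subst (Fin.zero ∈_) (sym []≡word) (∈-word π Fin.zero)))
  ... | q ∷ rs | _       = map-blocksFrom-∷ q [ proj₁ q ] rs

  basicChain-basic : 1 ≤ d → ∀ π → IsBasicColoringMonomial G (basicChain π)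
  basicChain-basic 1≤d π =
    let (chain , diffs≡) = Fresh⇒basic (blocks-Fresh (withℓ G (word G π)) uniq) (GSeq-∷ 1≤d π)
    in chain , π , diffs≡
    where
    uniq : Unique (keys (withℓ G (word G π)))
    uniq = subst Unique (sym (keys-withℓ (word G π))) (word-Unique π)

  basic⇒basicChain : ∀ {Bs} (basic : IsBasicColoringMonomial G Bs) → Bs ≡ basicChain (proj₁ (proj₂ basic))
  basic⇒basicChain {Bs} (chain , π , short≡diffs) = begin
    Bs                             ≡⟨ partialUnions-diffs (Linked.map p⊂q⇒p⊆q (Linked-++⁻ˡ (⊥ ∷ Bs) chain)) ⟨
    partialUnions ⊥ (diffs ⊥ Bs)   ≡⟨ cong (partialUnions ⊥) short≡diffs ⟨
    basicChain π                   ∎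
    where open ≡-Reasoning

  basicChain-separates : ∀ π {x y} → adj G x y ≡ true →
                         ∃ λ S → S ∈ basicChain π × ((x ∈ₛ S × y ∉ₛ S) ⊎ (y ∈ₛ S × x ∉ₛ S))
  basicChain-separates π {x} {y} xy
    with withℓ G (word G π) | keys-withℓ (word G π) | withℓ-increasing (word G π) | basicChain-cutSets π
  ... | []     | []≡word | _   | _ = ⊥-elim (¬Any[] (subst (x ∈_) (sym []≡word) (∈-word π x)))
  ... | q ∷ rs | keys≡   | inc | chain≡
    with cutsFrom-separating q rs inc (subst Unique (sym keys≡) (word-Unique π)) (∈-keys x) (∈-keys y) xy
    where
    ∈-keys : ∀ z → z ∈ keys (q ∷ rs)
    ∈-keys z = subst (z ∈_) (sym keys≡) (∈-word π z)
  ...   | m , m∈ , sep =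
    toSubset G (keys (q ∷ m)) , subst (_ ∈_) (sym chain≡) (∈-map⁺ _ m∈) , Sum.map lift lift sep
    where
    lift : ∀ {a b} → a ∈ keys (q ∷ m) × b ∉ keys (q ∷ m) →
           a ∈ₛ toSubset G (keys (q ∷ m)) × b ∉ₛ toSubset G (keys (q ∷ m))
    lift (a∈ , b∉) = ∈-toSubset⁺ a∈ , b∉ ∘ ∈-toSubset⁻ (keys (q ∷ m))

-- A permutation adapted to a proper colouring

module Canonical {d : ℕ} (G : Graph d) (f : Fin d → ℕ) (proper : ∀ u v → adj G u v ≡ true → f u ≢ f v) where

  lower : Fin d → Fin d → Bool
  lower v u = adj G u v ∧ (f u <ᵇ f v)

  lower⁺ : ∀ {u v} → adj G u v ≡ true → f u < f v → lower v u ≡ true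
  lower⁺ uv fu<fv = to T-≡ (from T-∧ (from T-≡ uv , <⇒<ᵇ fu<fv))

  lower⁻ : ∀ {u v} → lower v u ≡ true → adj G u v ≡ true × f u < f v
  lower⁻ {u} {v} low = let (uv , fu<fv) = to T-∧ (from T-≡ low) in to T-≡ uv , <ᵇ⇒< (f u) (f v) fu<fv

  -- depth v is the length of a longest path ending at v along which colours increase; such a path
  -- has at most f v edges, so f v + 1 rounds of the recursion suffice.
  depthUpTo : ℕ → Fin d → ℕ
  depthUpTo zero    v = 0
  depthUpTo (suc k) v = maxOver (lower v) (suc ∘ depthUpTo k) (allFin d)

  depth : Fin d → ℕ
  depth v = depthUpTo (suc (f v)) v

  depthUpTo-stable : ∀ k k′ v → f v < k → f v < k′ → depthUpTo k v ≡ depthUpTo k′ v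
  depthUpTo-stable (suc k) (suc k′) v (s≤s fv≤k) (s≤s fv≤k′) = maxOver-cong (lower v) (allFin d) λ low →
    let fu<fv = proj₂ (lower⁻ low)
    in cong suc (depthUpTo-stable k k′ _ (<-≤-trans fu<fv fv≤k) (<-≤-trans fu<fv fv≤k′))

  depth-fixpoint : ∀ v → depth v ≡ maxOver (lower v) (suc ∘ depth) (allFin d)
  depth-fixpoint v = maxOver-cong (lower v) (allFin d) λ low →
    cong suc (depthUpTo-stable (f v) (suc (f _)) _ (proj₂ (lower⁻ low)) ≤-refl)

  label : Fin d → Fin d × ℕ
  label v = v , depth v

  -- Colour first, then decreasing depth, then decreasing index: exactly the order in which two
  -- consecutive vertices of one colour class never form a cut.
  keyOrder : DecTotalOrder _ _ _
  keyOrder = On.decTotalOrder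
    (Lex.×-decTotalOrder ≤-decTotalOrder
      (Lex.×-decTotalOrder (Flip.decTotalOrder ≤-decTotalOrder) (Flip.decTotalOrder ≤-decTotalOrder)))
    (λ v → f v , depth v , toℕ v)

  open DecTotalOrder keyOrder using () renaming (_≤_ to _≼_; trans to ≼-trans)
  open import Data.List.Sort keyOrder using (sort; sort-↭; sort-↗)

  ≼⇒colour≤ : ∀ {u v} → u ≼ v → f u ≤ f v
  ≼⇒colour≤ (inj₁ (fu≤fv , _)) = fu≤fv
  ≼⇒colour≤ (inj₂ (fu≡fv , _)) = ≤-reflexive fu≡fv

  ≼-cut⇒colour< : ∀ {u v} → u ≼ v → isCut G (label u) (label v) ≡ true → f u < f v
  ≼-cut⇒colour< {u} {v} u≼v cut = ≤∧≢⇒< (≼⇒colour≤ u≼v) (λ fu≡fv → noCut u≼v fu≡fv (isCut⁻ G cut))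
    where
    noCut : u ≼ v → f u ≡ f v → ¬ (depth u < depth v ⊎ (depth u ≡ depth v × toℕ u < toℕ v))
    noCut (inj₁ (_ , fu≢fv))                     fu≡fv _                  = fu≢fv fu≡fv
    noCut (inj₂ (_ , inj₁ (dv≤du , du≢dv)))      _     (inj₁ du<dv)       = <⇒≱ du<dv dv≤du
    noCut (inj₂ (_ , inj₁ (dv≤du , du≢dv)))      _     (inj₂ (du≡dv , _)) = du≢dv du≡dv
    noCut (inj₂ (_ , inj₂ (du≡dv , _)))          _     (inj₁ du<dv)       = <-irrefl du≡dv du<dv
    noCut (inj₂ (_ , inj₂ (_ , tv≤tu)))          _     (inj₂ (_ , tu<tv)) = <⇒≱ tu<tv tv≤tu

  w : List (Fin d)
  w = sort (allFin d)

  w-sorted : AllPairs _≼_ w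
  w-sorted = Linked⇒AllPairs ≼-trans (sort-↗ (allFin d))

  w-Unique : Unique w
  w-Unique = ↭ₛ.Unique-resp-↭ (setoid (Fin d)) (↭⇒↭ₛ (↭-sym (sort-↭ (allFin d)))) (Unique.allFin⁺ d)

  ∈-w : ∀ v → v ∈ w
  ∈-w v = ∈-resp-↭ (↭-sym (sort-↭ (allFin d))) (∈-allFin v)

  length-w : length w ≡ d
  length-w = trans (↭-length (sort-↭ (allFin d))) (length-tabulate (λ i → i))

  module _ {pre v post} (split : pre ++ v ∷ post ≡ w) where

    pivot : All (_≼ v) pre × All (v ≼_) post
    pivot = AllPairs-pivot pre (subst (AllPairs _≼_) (sym split) w-sorted)

    before⇒colour≤ : ∀ {u} → u ∈ pre → f u ≤ f v
    before⇒colour≤ u∈ = ≼⇒colour≤ (All.lookup (proj₁ pivot) u∈)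

    colour<⇒before : ∀ {u} → f u < f v → u ∈ pre
    colour<⇒before {u} fu<fv with ∈-++⁻ pre (subst (u ∈_) (sym split) (∈-w u))
    ... | inj₁ u∈pre          = u∈pre
    ... | inj₂ (here refl)    = ⊥-elim (<-irrefl refl fu<fv)
    ... | inj₂ (there u∈post) =
      ⊥-elim (<⇒≱ fu<fv (≼⇒colour≤ (All.lookup (proj₂ pivot) u∈post)))

  w-labels : withℓ G w ≡ map label w
  w-labels = withℓ-labels G depth w λ pre v post split → begin
    maxOver (λ p → adj G (proj₁ p) v) (suc ∘ proj₂) (map label pre)
      ≡⟨ maxOver-map (λ p → adj G (proj₁ p) v) (suc ∘ proj₂) label pre ⟩
    maxOver (λ u → adj G u v) (suc ∘ depth) pre
      ≡⟨ maxOver-≡ _ (lower v) _ pre (allFin d)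
           (λ {u} u∈ uv → ∈-allFin u , lower⁺ uv (≤∧≢⇒< (before⇒colour≤ split u∈) (proper u v uv)))
           (λ _ low → let (uv , fu<fv) = lower⁻ low in colour<⇒before split fu<fv , uv) ⟩
    maxOver (lower v) (suc ∘ depth) (allFin d)
      ≡⟨ depth-fixpoint v ⟨
    depth v
      ∎
    where open ≡-Reasoning

  cut-levelSet : ∀ {n} → (∀ v → f v ≤ n) → ∀ pre {a b post} → pre ++ a ∷ b ∷ post ≡ w →
                 isCut G (label a) (label b) ≡ true → toSubset G (pre ++ [ a ]) ∈ levelSets n f
  cut-levelSet f≤n pre {a} {b} {post} split cut =
    ∈-levelSets (f a) (<-≤-trans fa<fb (f≤n b))
      (λ x∈ → [ before⇒colour≤ split , (λ { (here refl) → ≤-refl }) ]′ (∈-++⁻ pre (∈-toSubset⁻ G _ x∈)))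
      (λ fx≤fa → ∈-toSubset⁺ G (colour<⇒before (trans (++-assoc pre [ a ] _) split) (≤-<-trans fx≤fa fa<fb)))
    where
    fa<fb : f a < f b
    fa<fb = ≼-cut⇒colour< (All.lookup (proj₂ (pivot split)) (here refl)) cut

  cutSets-levelSets : ∀ {n} → (∀ v → f v ≤ n) → ∀ {S} → S ∈ cutSets G (map label w) → S ∈ levelSets n f
  cutSets-levelSets f≤n S∈ with ∈-cutSets-labelled⁻ G depth S∈
  ... | pre , a , b , post , split , refl , cut = cut-levelSet f≤n pre (sym split) cut

  π : Permutation′ d
  π = proj₁ (listPermutation w w-Unique ∈-w length-w)

  word-π : word G π ≡ w
  word-π = proj₂ (listPermutation w w-Unique ∈-w length-w)

  basicChain-levelSets : ∀ {n} → (∀ v → f v ≤ n) → ∀ {S} → S ∈ basicChain G π → S ∈ levelSets n f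
  basicChain-levelSets f≤n {S} S∈ = cutSets-levelSets f≤n (subst (S ∈_) chain≡ S∈)
    where
    chain≡ : basicChain G π ≡ cutSets G (map label w)
    chain≡ = trans (basicChain-cutSets G π)
                   (cong (cutSets G) (trans (cong (withℓ G) word-π) w-labels))

-- The correspondence

module _ {d : ℕ} (G : Graph d) (n : ℕ) where

  open RunLength (≡-dec {n = d} _≟ᵇ_)

  colourLevels : Coloring G (suc n) → List (Subset d)
  colourLevels φ = levelSets n (toℕ ∘ proj₁ φ)

  monomialOf : Coloring G (suc n) → List (Subset d × ℕ)
  monomialOf φ = runLengths (colourLevels φ)

  monomialOf-cong : ∀ {φ ψ : Coloring G (suc n)} → (∀ x → proj₁ φ x ≡ proj₁ ψ x) → monomialOf φ ≡ monomialOf ψ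
  monomialOf-cong φ≈ψ = cong runLengths (levelSets-cong n (λ x → cong toℕ (φ≈ψ x)))

  colour-≤ : ∀ (φ : Coloring G (suc n)) x → toℕ (proj₁ φ x) ≤ n
  colour-≤ φ x = s≤s⁻¹ (toℕ<n (proj₁ φ x))

  rank-monomialOf : ∀ φ x → rank (expand (monomialOf φ)) x ≡ toℕ (proj₁ φ x)
  rank-monomialOf φ x =
    trans (cong (λ L → rank L x) (expand-runLengths (colourLevels φ))) (rank-levelSets n _ x (colour-≤ φ x))

  monomialOf-IsMonomial : ∀ φ → IsMonomial (monomialOf φ)
  monomialOf-IsMonomial φ =
    Linked.map (λ (p⊆q , p≢q) → ⊆∧≢⇒⊂ p⊆q p≢q) (runLengths-Linked {R = _⊆_} (levelSets-Chain n _)) ,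
    runLengths-positive (colourLevels φ)

  degree-monomialOf : ∀ φ → degree (monomialOf φ) ≡ n
  degree-monomialOf φ = trans (sym (length-expand (monomialOf φ)))
                              (trans (cong length (expand-runLengths (colourLevels φ))) (length-levelSets n _))

  monomialOf-basic : 1 ≤ d → ∀ φ → ∃ λ B → IsBasicColoringMonomial G B × Divides B (monomialOf φ)
  monomialOf-basic 1≤d φ = basicChain G π , basicChain-basic G 1≤d π ,
    All.tabulate (λ T∈ → ∈-expand⁻ (monomialOf φ)
      (subst (_ ∈_) (sym (expand-runLengths (colourLevels φ))) (basicChain-levelSets (colour-≤ φ) T∈)))
    where open Canonical G (toℕ ∘ proj₁ φ) (λ u v uv eq → proj₂ φ u v uv (toℕ-injective eq))

  toKMonomial : 1 ≤ d → Coloring G (suc n) → KMonomial G n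
  toKMonomial 1≤d φ = monomialOf φ , (monomialOf-IsMonomial φ , monomialOf-basic 1≤d φ) , degree-monomialOf φ

  expand-Chain : ∀ {M} → IsMonomial M → Chain (expand M)
  expand-Chain (increasing , positive) = expand-Linked {R = _⊆_} ⊆-refl (Linked.map p⊂q⇒p⊆q increasing) positive

  rank-proper : ∀ {M} → IsColoringMonomial G M → ∀ x y → adj G x y ≡ true →
                rank (expand M) x ≢ rank (expand M) y
  rank-proper {M} (mono , B , basic , B∣M) x y xy with basicChain-separates G (proj₁ (proj₂ basic)) xy
  ... | S , S∈ , sep =
    [ (λ (x∈ , y∉) → <⇒≢ (separate x∈ y∉)) , (λ (y∈ , x∉) → <⇒≢ (separate y∈ x∉) ∘ sym) ]′ sep
    where
    S∈M : S ∈ expand M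
    S∈M = ∈-expand⁺ (proj₂ mono) (All.lookup B∣M (subst (S ∈_) (sym (basic⇒basicChain G basic)) S∈))
    separate : ∀ {a b} → a ∈ₛ S → b ∉ₛ S → rank (expand M) a < rank (expand M) b
    separate = rank-separates (expand-Chain mono) S∈M

  colouringOf : KMonomial G n → Coloring G (suc n)
  colouringOf (M , coloring , deg) = colour , λ x y xy → rank-proper coloring x y xy ∘ colour≡⇒rank≡
    where
    length≡n : length (expand M) ≡ n
    length≡n = trans (length-expand M) deg
    colour : Fin d → Fin (suc n)
    colour x = fromℕ< (s≤s (subst (rank (expand M) x ≤_) length≡n (rank-≤-length (expand M) x)))
    colour≡⇒rank≡ : ∀ {x y} → colour x ≡ colour y → rank (expand M) x ≡ rank (expand M) y
    colour≡⇒rank≡ eq = trans (sym (toℕ-fromℕ< _)) (trans (cong toℕ eq) (toℕ-fromℕ< _))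

  monomialOf-injective : ∀ {φ ψ} → monomialOf φ ≡ monomialOf ψ → ∀ x → proj₁ φ x ≡ proj₁ ψ x
  monomialOf-injective {φ} {ψ} eq x = toℕ-injective (begin
    toℕ (proj₁ φ x)                   ≡⟨ rank-monomialOf φ x ⟨
    rank (expand (monomialOf φ)) x    ≡⟨ cong (λ M → rank (expand M) x) eq ⟩
    rank (expand (monomialOf ψ)) x    ≡⟨ rank-monomialOf ψ x ⟩
    toℕ (proj₁ ψ x)                   ∎)
    where open ≡-Reasoning

  monomialOf-colouringOf : ∀ M → monomialOf (colouringOf M) ≡ proj₁ M
  monomialOf-colouringOf K@(M , ((increasing , positive) , _) , deg) = begin
    runLengths (levelSets n (toℕ ∘ proj₁ (colouringOf K)))
      ≡⟨ cong runLengths (levelSets-cong n (λ x → toℕ-fromℕ< _)) ⟩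
    runLengths (levelSets n (rank L))
      ≡⟨ cong (λ k → runLengths (levelSets k (rank L))) (trans (length-expand M) deg) ⟨
    runLengths (levelSets (length L) (rank L))
      ≡⟨ cong runLengths (levelSets-rank (expand-Chain (increasing , positive))) ⟩
    runLengths L
      ≡⟨ runLengths-expand (Linked.map (λ p⊂q p≡q → ⊂-irref p≡q p⊂q) increasing) positive ⟩
    M ∎
    where
    open ≡-Reasoning
    L = expand M

theorem2p3 : ∀ {d : ℕ} (G : Graph d) → 1 ≤ d → (n : ℕ) →
    Bijection (ColoringSetoid G (suc n)) (KMonomialSetoid G n)
theorem2p3 G 1≤d n = record
  { to        = toKMonomial G n 1≤d
  ; cong      = λ {φ} {ψ} → monomialOf-cong G n {φ} {ψ}
  ; bijective = (λ {φ} {ψ} → monomialOf-injective G n {φ} {ψ}) , surjective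
  }
  where
  surjective : ∀ M → ∃ λ φ → ∀ {ψ} → (∀ x → proj₁ ψ x ≡ proj₁ φ x) → monomialOf G n ψ ≡ proj₁ M
  surjective M = colouringOf G n M , λ {ψ} ψ≈φ →
    trans (monomialOf-cong G n {ψ} {colouringOf G n M} ψ≈φ) (monomialOf-colouringOf G n M)
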